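{- Let $\sigma\in\mathfrak{S}_n$ and let $F=\{i:\sigma(i)>i\}$, $G=\{i:\sigma(i)<i\}$, $H=\{i:\sigma(i)=i\}$. Let $u_1,\dots,u_n$ be the listing of $[n]$ obtained by taking the elements of $H$ in increasing order, then the elements of $G$ in increasing order, then the elements of $F$ in decreasing order. Call $u_j\in[n]\setminus H$ a cycle closer if, in the digraph $L|_{\{u_1,\dots,u_{j-1}\}}$, $u_j$ and $\sigma(u_j)$ are respectively the final and initial vertices of one and the same directed path, so that inserting the edge $u_j\to\sigma(u_j)$ turns this path into a cycle. Then an element $u\in[n]$ is a cycle closer if and only if it is a cycle valley minimum, i.e. a cycle valley of $\sigma$ that is the smallest element of its cycle.
   Context: $\mathfrak{S}_n$ is the set of permutations of $[n]$. For $S\subseteq[n]$, $L|_S$ is the directed graph on vertex set $[n]$ with edges $u\to\sigma(u)$ for $u\in S$. An index $i$ is a cycle valley of $\sigma$ if $\sigma^{ -1}(i)>i<\sigma(i)$. -}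

module Defs where

open import Data.Nat using (ℕ; zero; suc)
open import Data.Fin as Fin using (Fin; _<_; _≤_; _<?_; _≟_)
open import Data.Fin.Permutation using (Permutation′; _⟨$⟩ʳ_; _⟨$⟩ˡ_)
open import Data.List using (List; _∷_; _++_; filter; reverse; allFin)
open import Data.List.Membership.Propositional using (_∈_)
open import Data.Product using (Σ; ∃; ∃-syntax; _×_)
open import Relation.Nullary using (¬_)
open import Relation.Binary.PropositionalEquality using (_≡_)

iter : ∀ {n} → Permutation′ n → ℕ → Fin n → Fin n
iter σ zero    i = i
iter σ (suc k) i = σ ⟨$⟩ʳ (iter σ k i)

listing : ∀ {n} → Permutation′ n → List (Fin n)
listing {n} σ =
  filter (λ i → σ ⟨$⟩ʳ i ≟ i) (allFin n)
  ++ filter (λ i → σ ⟨$⟩ʳ i <? i) (allFin n)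
  ++ reverse (filter (λ i → i <? σ ⟨$⟩ʳ i) (allFin n))

-- Directed path from a to b in the digraph L|_S (edges v → σ v for v ∈ S)
data Path {n} (σ : Permutation′ n) (S : List (Fin n)) : Fin n → Fin n → Set where
  here  : ∀ {a} → Path σ S a a
  there : ∀ {a b} → a ∈ S → Path σ S (σ ⟨$⟩ʳ a) b → Path σ S a b

CycleCloser : ∀ {n} → Permutation′ n → Fin n → Set
CycleCloser σ u =
  ¬ (σ ⟨$⟩ʳ u ≡ u) ×
  Σ (List _) λ xs → Σ (List _) λ ys →
    (listing σ ≡ xs ++ (u ∷ ys)) × Path σ xs (σ ⟨$⟩ʳ u) u

CycleValley : ∀ {n} → Permutation′ n → Fin n → Set
CycleValley σ i = (i < σ ⟨$⟩ˡ i) × (i < σ ⟨$⟩ʳ i)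

CycleMin : ∀ {n} → Permutation′ n → Fin n → Set
CycleMin σ i = ∀ k → i ≤ iter σ k i

CycleValleyMin : ∀ {n} → Permutation′ n → Fin n → Set
CycleValleyMin σ i = CycleValley σ i × CycleMin σ i

-- Rank the points so that the listing is strictly increasing: fixed points by
-- value, then the points with σ(i) < i by value, then the points with σ(i) > i
-- by decreasing value.  If u is a cycle closer with prefix xs, no point of xs
-- below u has σ(i) > i (it would come after u), so σ maps points of xs below u
-- to points below u.  Every point of the cycle of u, including σ⁻¹(u), reaches
-- u along the path σ(u) ⇝ u through xs, hence none of them lies below u.
-- Conversely, for a cycle valley minimum u every other point of its cycle lies
-- above u and so precedes u in the listing; following σ from σ(u) until it
-- returns to u is the required path.
module Submission where

open import Defs
open import Data.Nat using (ℕ)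
open import Data.Fin using (Fin)
open import Data.Fin.Permutation using (Permutation′)
open import Data.Product using (_×_)

open import Data.Nat as ℕ using (zero; suc; _+_; _∸_)
import Data.Nat.Properties as ℕ
open import Data.Fin as Fin using (toℕ; _<_; _≤_; _≟_; _<?_)
open import Data.Fin.Properties using (<-cmp; ≤∧≢⇒<; toℕ<n; pigeonhole)
open import Data.Fin.Permutation using (_⟨$⟩ʳ_; _⟨$⟩ˡ_; inverseˡ; inverseʳ)
open import Data.List using (List; []; _∷_; _++_; filter; reverse; allFin)
open import Data.List.Properties using (unfold-reverse)
open import Data.List.Membership.Propositional using (_∈_)
open import Data.List.Membership.Propositional.Properties
  using (∈-++⁺ˡ; ∈-++⁺ʳ; ∈-∃++; ∈-filter⁺; ∈-allFin)
open import Data.List.Relation.Unary.Any using (here; there)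
import Data.List.Relation.Unary.Any.Properties as Any
open import Data.List.Relation.Unary.All as All using (All; []; _∷_)
import Data.List.Relation.Unary.All.Properties as All
open import Data.List.Relation.Unary.AllPairs using (AllPairs; []; _∷_)
import Data.List.Relation.Unary.AllPairs.Properties as AllPairs
open import Data.Product using (_,_; ∃-syntax; uncurry)
open import Data.Empty using (⊥-elim)
open import Function using (_∘_; id; flip; Injection)
open import Function.Properties.Inverse using (↔⇒↣)
open import Level using (Level)
open import Relation.Binary using (Rel; Asymmetric; Tri; tri<; tri≈; tri>)
open import Relation.Binary.PropositionalEquality
open import Relation.Nullary using (yes; no)
open import Relation.Unary using (Pred; Decidable)

private
  variable
    a p r s : Level
    A : Set a

All-reverse⁺ : {P : Pred A p} → ∀ {xs} → All P xs → All P (reverse xs)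
All-reverse⁺ pxs = All.tabulate (All.lookup pxs ∘ Any.reverse⁻)

module _ {R : Rel A r} where

  AllPairs-restrict : {S : Rel A s} {P : Pred A p} →
    (∀ {x y} → P x → P y → R x y → S x y) →
    ∀ {xs} → All P xs → AllPairs R xs → AllPairs S xs
  AllPairs-restrict f [] [] = []
  AllPairs-restrict f (px ∷ pxs) (rx ∷ rxs) =
    All.zipWith (uncurry (f px)) (pxs , rx) ∷ AllPairs-restrict f pxs rxs

  AllPairs-reverse⁺ : ∀ {xs} → AllPairs R xs → AllPairs (flip R) (reverse xs)
  AllPairs-reverse⁺ {[]} [] = []
  AllPairs-reverse⁺ {x ∷ xs} (rx ∷ rxs) rewrite unfold-reverse x xs =
    AllPairs.++⁺ (AllPairs-reverse⁺ rxs) ([] ∷ [])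
      (All.map (_∷ []) (All-reverse⁺ rx))

  ∈-prefix⇒related : ∀ xs {u ys v} → AllPairs R (xs ++ u ∷ ys) → v ∈ xs → R v u
  ∈-prefix⇒related (x ∷ xs) (rx ∷ _) (here refl) = All.lookup rx (∈-++⁺ʳ xs (here refl))
  ∈-prefix⇒related (x ∷ xs) (_ ∷ rxs) (there v∈xs) = ∈-prefix⇒related xs rxs v∈xs

  related⇒∈-prefix : Asymmetric R → ∀ xs {u ys v} → AllPairs R (xs ++ u ∷ ys) →
    v ∈ xs ++ u ∷ ys → R v u → v ∈ xs
  related⇒∈-prefix asym [] _ (here refl) Ruu = ⊥-elim (asym Ruu Ruu)
  related⇒∈-prefix asym [] (ru ∷ _) (there v∈ys) Rvu = ⊥-elim (asym Rvu (All.lookup ru v∈ys))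
  related⇒∈-prefix asym (x ∷ xs) _ (here refl) _ = here refl
  related⇒∈-prefix asym (x ∷ xs) (_ ∷ rxs) (there v∈) Rvu =
    there (related⇒∈-prefix asym xs rxs v∈ Rvu)

filter-allFin-AllPairs : ∀ {n} {P : Pred (Fin n) p} (P? : Decidable P) {S : Rel (Fin n) s} →
  (∀ {i j} → P i → P j → i < j → S i j) → AllPairs S (filter P? (allFin n))
filter-allFin-AllPairs {n = n} P? mono =
  AllPairs-restrict mono (All.all-filter P? (allFin n))
    (AllPairs.filter⁺ P? (AllPairs.tabulate⁺-< id))

module _ {n} (σ : Permutation′ n) where

  iter-shift : ∀ k v → iter σ k (σ ⟨$⟩ʳ v) ≡ iter σ (suc k) v
  iter-shift zero    v = refl
  iter-shift (suc k) v = cong (σ ⟨$⟩ʳ_) (iter-shift k v)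

  iter-+ : ∀ j k v → iter σ (j + k) v ≡ iter σ j (iter σ k v)
  iter-+ zero    k v = refl
  iter-+ (suc j) k v = cong (σ ⟨$⟩ʳ_) (iter-+ j k v)

  iter-injective : ∀ k {v w} → iter σ k v ≡ iter σ k w → v ≡ w
  iter-injective zero    eq = eq
  iter-injective (suc k) eq = iter-injective k (Injection.injective (↔⇒↣ σ) eq)

  iter-returns : ∀ v → ∃[ m ] iter σ (suc m) v ≡ v
  iter-returns v
    with i , j , i<j , same ← pigeonhole (ℕ.n<1+n n) (λ (k : Fin (suc n)) → iter σ (toℕ k) v)
    with d , i+1+d≡j ← ℕ.m≤n⇒∃[o]m+o≡n i<j
    = d , sym (iter-injective (toℕ i) (begin
      iter σ (toℕ i) v                  ≡⟨ same ⟩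
      iter σ (toℕ j) v                  ≡⟨ cong (λ k → iter σ k v) j≡i+[1+d] ⟩
      iter σ (toℕ i + suc d) v          ≡⟨ iter-+ (toℕ i) (suc d) v ⟩
      iter σ (toℕ i) (iter σ (suc d) v) ∎))
    where
    open ≡-Reasoning
    j≡i+[1+d] : toℕ j ≡ toℕ i + suc d
    j≡i+[1+d] = sym (trans (ℕ.+-suc (toℕ i) d) i+1+d≡j)

  module _ {S : List (Fin n)} where

    Path-preserves : (P : Pred (Fin n) p) → (∀ {v} → v ∈ S → P v → P (σ ⟨$⟩ʳ v)) →
      ∀ {v w} → Path σ S v w → P v → P w
    Path-preserves P step here         pv = pv
    Path-preserves P step (there v∈ q) pv = Path-preserves P step q (step v∈ pv)

    Path-iter : ∀ {u} → Path σ S (σ ⟨$⟩ʳ u) u → ∀ k → Path σ S (iter σ k u) u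
    Path-iter {u} cycle zero    = here
    Path-iter {u} cycle (suc k) = advance (Path-iter cycle k)
      where
      advance : ∀ {v} → Path σ S v u → Path σ S (σ ⟨$⟩ʳ v) u
      advance here        = cycle
      advance (there _ q) = q

    Path-from-predecessor : ∀ {v w} → Path σ S v w → v ≢ w → Path σ S (σ ⟨$⟩ˡ w) w
    Path-from-predecessor here v≢v = ⊥-elim (v≢v refl)
    Path-from-predecessor (there {v} {w} v∈ q) _ with σ ⟨$⟩ʳ v ≟ w
    ... | yes refl = subst (λ x → Path σ S x (σ ⟨$⟩ʳ v)) (sym (inverseˡ σ)) (there v∈ here)
    ... | no σv≢w  = Path-from-predecessor q σv≢w

    iter⇒Path : ∀ m {v w} → iter σ m v ≡ w →
      (∀ j → iter σ j v ≢ w → iter σ j v ∈ S) → Path σ S v w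
    iter⇒Path zero hit _ = subst (Path σ S _) hit here
    iter⇒Path (suc m) {v} {w} hit avoid with v ≟ w
    ... | yes refl = here
    ... | no v≢w   = there (avoid 0 v≢w) (iter⇒Path m (trans (iter-shift m v) hit) avoid′)
      where
      avoid′ : ∀ j → iter σ j (σ ⟨$⟩ʳ v) ≢ w → iter σ j (σ ⟨$⟩ʳ v) ∈ S
      avoid′ j ne = subst (_∈ S) (sym (iter-shift j v))
                          (avoid (suc j) (ne ∘ trans (iter-shift j v)))

module ListingOrder {n} (σ : Permutation′ n) where

  rank : Fin n → ℕ
  rank v with <-cmp (σ ⟨$⟩ʳ v) v
  ... | tri< _ _ _ = n + toℕ v
  ... | tri≈ _ _ _ = toℕ v
  ... | tri> _ _ _ = n + n + (n ∸ toℕ v)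

  rank-fixed : ∀ {v} → σ ⟨$⟩ʳ v ≡ v → rank v ≡ toℕ v
  rank-fixed {v} σv≡v with <-cmp (σ ⟨$⟩ʳ v) v
  ... | tri< _ σv≢v _ = ⊥-elim (σv≢v σv≡v)
  ... | tri≈ _ _ _    = refl
  ... | tri> _ σv≢v _ = ⊥-elim (σv≢v σv≡v)

  rank-down : ∀ {v} → σ ⟨$⟩ʳ v < v → rank v ≡ n + toℕ v
  rank-down {v} σv<v with <-cmp (σ ⟨$⟩ʳ v) v
  ... | tri< _ _ _    = refl
  ... | tri≈ σv≮v _ _ = ⊥-elim (σv≮v σv<v)
  ... | tri> σv≮v _ _ = ⊥-elim (σv≮v σv<v)

  rank-up : ∀ {v} → v < σ ⟨$⟩ʳ v → rank v ≡ n + n + (n ∸ toℕ v)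
  rank-up {v} v<σv with <-cmp (σ ⟨$⟩ʳ v) v
  ... | tri< _ _ v≮σv = ⊥-elim (v≮σv v<σv)
  ... | tri≈ _ _ v≮σv = ⊥-elim (v≮σv v<σv)
  ... | tri> _ _ _    = refl

  fixed⇒rank<n : ∀ {v} → σ ⟨$⟩ʳ v ≡ v → rank v ℕ.< n
  fixed⇒rank<n {v} σv≡v = subst (ℕ._< n) (sym (rank-fixed σv≡v)) (toℕ<n v)

  down⇒n≤rank : ∀ {v} → σ ⟨$⟩ʳ v < v → n ℕ.≤ rank v
  down⇒n≤rank {v} σv<v = subst (n ℕ.≤_) (sym (rank-down σv<v)) (ℕ.m≤m+n n (toℕ v))

  down⇒rank<2n : ∀ {v} → σ ⟨$⟩ʳ v < v → rank v ℕ.< n + n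
  down⇒rank<2n {v} σv<v =
    subst (ℕ._< n + n) (sym (rank-down σv<v)) (ℕ.+-monoʳ-< n (toℕ<n v))

  up⇒2n≤rank : ∀ {v} → v < σ ⟨$⟩ʳ v → n + n ℕ.≤ rank v
  up⇒2n≤rank {v} v<σv = subst (n + n ℕ.≤_) (sym (rank-up v<σv)) (ℕ.m≤m+n (n + n) _)

  up-rank-antitone : ∀ {v w} → v < σ ⟨$⟩ʳ v → w < σ ⟨$⟩ʳ w → v < w → rank w ℕ.< rank v
  up-rank-antitone {v} {w} v<σv w<σw v<w =
    subst₂ ℕ._<_ (sym (rank-up w<σw)) (sym (rank-up v<σv))
      (ℕ.+-monoʳ-< (n + n) (ℕ.∸-monoʳ-< v<w (ℕ.<⇒≤ (toℕ<n w))))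

  up-rank-reflects : ∀ {v w} → v < σ ⟨$⟩ʳ v → w < σ ⟨$⟩ʳ w → rank w ℕ.< rank v → v < w
  up-rank-reflects v<σv w<σw rw<rv rewrite rank-up v<σv | rank-up w<σw =
    ℕ.∸-cancelʳ-< (ℕ.+-cancelˡ-< (n + n) _ _ rw<rv)

  _≺_ : Rel (Fin n) _
  v ≺ w = rank v ℕ.< rank w

  private
    fixed? : Decidable (λ v → σ ⟨$⟩ʳ v ≡ v)
    fixed? v = σ ⟨$⟩ʳ v ≟ v

    down? : Decidable (λ v → σ ⟨$⟩ʳ v < v)
    down? v = σ ⟨$⟩ʳ v <? v

    up? : Decidable (λ v → v < σ ⟨$⟩ʳ v)
    up? v = v <? σ ⟨$⟩ʳ v

    fixed down up : List (Fin n)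
    fixed  = filter fixed? (allFin n)
    down   = filter down? (allFin n)
    up     = filter up? (allFin n)

    separated : ∀ {c xs ys} → All (λ v → rank v ℕ.< c) xs → All (λ w → c ℕ.≤ rank w) ys →
      All (λ v → All (v ≺_) ys) xs
    separated below above = All.map (λ rv<c → All.map (ℕ.<-≤-trans rv<c) above) below

  listing-sorted : AllPairs _≺_ (listing σ)
  listing-sorted =
    AllPairs.++⁺ fixed-sorted (AllPairs.++⁺ down-sorted up-sorted
      (separated (All.map down⇒rank<2n all-down) (All.map up⇒2n≤rank all-up)))
      (separated (All.map fixed⇒rank<n (All.all-filter fixed? (allFin n)))
         (All.++⁺ (All.map down⇒n≤rank all-down)
                  (All.map (ℕ.≤-trans (ℕ.m≤m+n n n) ∘ up⇒2n≤rank) all-up)))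
    where
    all-down : All (λ v → σ ⟨$⟩ʳ v < v) down
    all-down = All.all-filter down? (allFin n)

    all-up : All (λ v → v < σ ⟨$⟩ʳ v) (reverse up)
    all-up = All-reverse⁺ (All.all-filter up? (allFin n))

    fixed-sorted : AllPairs _≺_ fixed
    fixed-sorted = filter-allFin-AllPairs fixed? λ σv≡v σw≡w v<w →
      subst₂ ℕ._<_ (sym (rank-fixed σv≡v)) (sym (rank-fixed σw≡w)) v<w

    down-sorted : AllPairs _≺_ down
    down-sorted = filter-allFin-AllPairs down? λ σv<v σw<w v<w →
      subst₂ ℕ._<_ (sym (rank-down σv<v)) (sym (rank-down σw<w)) (ℕ.+-monoʳ-< n v<w)

    up-sorted : AllPairs _≺_ (reverse up)
    up-sorted = AllPairs-reverse⁺ (filter-allFin-AllPairs up? up-rank-antitone)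

  ∈-listing : ∀ v → v ∈ listing σ
  ∈-listing v with <-cmp (σ ⟨$⟩ʳ v) v
  ... | tri< σv<v _ _ = ∈-++⁺ʳ fixed (∈-++⁺ˡ (∈-filter⁺ down? (∈-allFin v) σv<v))
  ... | tri≈ _ σv≡v _ = ∈-++⁺ˡ (∈-filter⁺ fixed? (∈-allFin v) σv≡v)
  ... | tri> _ _ v<σv =
    ∈-++⁺ʳ fixed (∈-++⁺ʳ down (Any.reverse⁺ (∈-filter⁺ up? (∈-allFin v) v<σv)))

  module _ {xs ys u} (split : listing σ ≡ xs ++ u ∷ ys) where

    up-∈-prefix⇒above : σ ⟨$⟩ʳ u ≢ u → ∀ {v} → v ∈ xs → v < σ ⟨$⟩ʳ v → u < v
    up-∈-prefix⇒above σu≢u {v} v∈xs v<σv = above (<-cmp (σ ⟨$⟩ʳ u) u)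
      where
      v≺u : v ≺ u
      v≺u = ∈-prefix⇒related xs (subst (AllPairs _≺_) split listing-sorted) v∈xs

      above : Tri (σ ⟨$⟩ʳ u < u) (σ ⟨$⟩ʳ u ≡ u) (u < σ ⟨$⟩ʳ u) → u < v
      above (tri< σu<u _ _) = ⊥-elim (ℕ.<-asym v≺u (ℕ.<-≤-trans (down⇒rank<2n σu<u) (up⇒2n≤rank v<σv)))
      above (tri≈ _ σu≡u _) = ⊥-elim (σu≢u σu≡u)
      above (tri> _ _ u<σu) = up-rank-reflects u<σu v<σv v≺u

    above⇒∈-prefix : u < σ ⟨$⟩ʳ u → ∀ {v} → u < v → v ∈ xs
    above⇒∈-prefix u<σu {v} u<v =
      related⇒∈-prefix ℕ.<-asym xs (subst (AllPairs _≺_) split listing-sorted)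
        (subst (v ∈_) split (∈-listing v)) v≺u
      where
      below-ups : rank v ℕ.< n + n → v ≺ u
      below-ups rv<2n = ℕ.<-≤-trans rv<2n (up⇒2n≤rank u<σu)

      v≺u : v ≺ u
      v≺u = by-kind (<-cmp (σ ⟨$⟩ʳ v) v)
        where
        by-kind : Tri (σ ⟨$⟩ʳ v < v) (σ ⟨$⟩ʳ v ≡ v) (v < σ ⟨$⟩ʳ v) → v ≺ u
        by-kind (tri< σv<v _ _) = below-ups (down⇒rank<2n σv<v)
        by-kind (tri≈ _ σv≡v _) = below-ups (ℕ.<-≤-trans (fixed⇒rank<n σv≡v) (ℕ.m≤m+n n n))
        by-kind (tri> _ _ v<σv) = up-rank-antitone u<σu v<σv u<v

module _ {n} (σ : Permutation′ n) (u : Fin n) where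
  open ListingOrder σ

  closer⇒valleyMin : CycleCloser σ u → CycleValleyMin σ u
  closer⇒valleyMin (σu≢u , xs , ys , split , cycle) =
    (u<σ⁻¹u , u<σu) , λ k → reaches⇒≥ (Path-iter σ cycle k)
    where
    stays-below : ∀ {v} → v ∈ xs → v < u → σ ⟨$⟩ʳ v < u
    stays-below {v} v∈xs v<u with <-cmp (σ ⟨$⟩ʳ v) v
    ... | tri< σv<v _ _ = ℕ.<-trans σv<v v<u
    ... | tri≈ _ σv≡v _ = subst (_< u) (sym σv≡v) v<u
    ... | tri> _ _ v<σv = ⊥-elim (ℕ.<-asym v<u (up-∈-prefix⇒above split σu≢u v∈xs v<σv))

    reaches⇒≥ : ∀ {w} → Path σ xs w u → u ≤ w
    reaches⇒≥ w⇝u = ℕ.≮⇒≥ λ w<u → ℕ.<-irrefl refl (Path-preserves σ (_< u) stays-below w⇝u w<u)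

    u<σu : u < σ ⟨$⟩ʳ u
    u<σu = ≤∧≢⇒< (reaches⇒≥ cycle) (σu≢u ∘ sym)

    u<σ⁻¹u : u < σ ⟨$⟩ˡ u
    u<σ⁻¹u = ≤∧≢⇒< (reaches⇒≥ (Path-from-predecessor σ cycle σu≢u))
      (λ u≡σ⁻¹u → σu≢u (trans (cong (σ ⟨$⟩ʳ_) u≡σ⁻¹u) (inverseʳ σ)))

  valleyMin⇒closer : CycleValleyMin σ u → CycleCloser σ u
  valleyMin⇒closer ((_ , u<σu) , minimal)
    with xs , ys , split ← ∈-∃++ (∈-listing u)
    with m , returns ← iter-returns σ u
    = (λ σu≡u → ℕ.<-irrefl (cong toℕ (sym σu≡u)) u<σu) , xs , ys , split ,
      iter⇒Path σ m (trans (iter-shift σ m u) returns) other-∈-prefix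
    where
    other-∈-prefix : ∀ j → iter σ j (σ ⟨$⟩ʳ u) ≢ u → iter σ j (σ ⟨$⟩ʳ u) ∈ xs
    other-∈-prefix j ≢u = above⇒∈-prefix split u<σu
      (≤∧≢⇒< (subst (u ≤_) (sym (iter-shift σ j u)) (minimal (suc j))) (≢u ∘ sym))

lemma6p5 : ∀ (n : ℕ) (σ : Permutation′ n) (u : Fin n) →
    (CycleCloser σ u → CycleValleyMin σ u) × (CycleValleyMin σ u → CycleCloser σ u)
lemma6p5 n σ u = closer⇒valleyMin σ u , valleyMin⇒closer σ u
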